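{- Let $\mathcal{S}=\langle\mathbf{Fm},\vdash\rangle$ be a logic over a language containing a unary connective $\neg$, and suppose there exist a formula $\alpha\in\mathit{Fm}$ with $\not\vdash\alpha$ and a variable $p\in V$ with $p\notin\mathrm{var}(\alpha)$. Then ECQ fails in the left variable inclusion companion $\mathcal{S}^l=\langle\mathbf{Fm},\vdash^l\rangle$ of $\mathcal{S}$; specifically $\{p,\neg p\}\not\vdash^l\alpha$.
   Context: $\mathbf{Fm}$ is the formula algebra of a logical language $\mathcal{L}$ (connectives of finite arity, including unary $\neg$) over a countably infinite set $V$ of variables, universe $\mathit{Fm}$. A logic is a pair $\langle\mathbf{Fm},\vdash\rangle$ with $\vdash\subseteq\mathcal{P}(\mathit{Fm})\times\mathit{Fm}$ reflexive, transitive (if $\Delta\vdash\psi$ for all $\psi\in\Sigma$ and $\Sigma\vdash\varphi$ then $\Delta\vdash\varphi$) and closed under substitutions. $\mathrm{var}(\varphi)$ is the set of variables of $\varphi$, $\mathrm{var}(\Gamma)=\bigcup_{\gamma\in\Gamma}\mathrm{var}(\gamma)$. Left variable inclusion companion: $\Gamma\vdash^l\varphi$ iff there is $\Gamma'\subseteq\Gamma$ with $\mathrm{var}(\Gamma')\subseteq\mathrm{var}(\varphi)$ and $\Gamma'\vdash\varphi$. ECQ holds in a logic $\langle\mathbf{Fm},\vdash'\rangle$ if $\{\alpha,\neg\alpha\}\vdash'\beta$ for all formulas $\alpha,\beta$; ECQ fails if this is not the case. -}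

module Defs where

open import Level using (0ℓ)
open import Data.Nat using (ℕ; suc)
open import Data.Vec using (Vec; []; _∷_)
open import Data.Product using (Σ; _×_)
open import Data.Sum using (_⊎_)
open import Relation.Unary using (Pred; _∈_; _⊆_)
open import Relation.Binary.PropositionalEquality using (_≡_)

-- A language: a type of connectives, each of finite arity, together with
-- the distinguished unary connective ¬ (built into the formula type below).
record Language : Set₁ where
  field
    Conn  : Set
    arity : Conn → ℕ

module _ (L : Language) where
  open Language L

  data Fm : Set where
    var : ℕ → Fm
    ¬′  : Fm → Fm
    op  : (c : Conn) → Vec Fm (arity c) → Fm

  Subst : Set
  Subst = ℕ → Fm

  mutual
    sub : Subst → Fm → Fm
    sub σ (var x)   = σ x
    sub σ (¬′ φ)    = ¬′ (sub σ φ)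
    sub σ (op c φs) = op c (subs σ φs)

    subs : ∀ {n} → Subst → Vec Fm n → Vec Fm n
    subs σ []       = []
    subs σ (φ ∷ φs) = sub σ φ ∷ subs σ φs

  mutual
    data _occursIn_ (x : ℕ) : Fm → Set where
      here : x occursIn var x
      neg  : ∀ {φ} → x occursIn φ → x occursIn ¬′ φ
      arg  : ∀ {c φs} → x occursInAny φs → x occursIn op c φs

    data _occursInAny_ (x : ℕ) : ∀ {n} → Vec Fm n → Set where
      hd : ∀ {n φ} {φs : Vec Fm n} → x occursIn φ → x occursInAny (φ ∷ φs)
      tl : ∀ {n φ} {φs : Vec Fm n} → x occursInAny φs → x occursInAny (φ ∷ φs)

  FmSet : Set₁
  FmSet = Pred Fm 0ℓ

  subSet : Subst → FmSet → FmSet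
  subSet σ Γ φ = Σ Fm (λ γ → γ ∈ Γ × φ ≡ sub σ γ)

  ∅F : FmSet
  ∅F _ = Data.Empty.⊥
    where import Data.Empty

  pair : Fm → Fm → FmSet
  pair a b φ = φ ≡ a ⊎ φ ≡ b

  Consequence : Set₂
  Consequence = FmSet → Fm → Set₁

  record IsLogic (_⊢_ : Consequence) : Set₂ where
    field
      reflexive  : ∀ {Γ φ} → φ ∈ Γ → Γ ⊢ φ
      transitive : ∀ {Δ Σ φ} → (∀ {ψ} → ψ ∈ Σ → Δ ⊢ ψ) → Σ ⊢ φ → Δ ⊢ φ
      structural : ∀ {Γ φ} (σ : Subst) → Γ ⊢ φ → subSet σ Γ ⊢ sub σ φ

  VarsIncluded : FmSet → Fm → Set
  VarsIncluded Γ φ = ∀ {γ} → γ ∈ Γ → ∀ {x} → x occursIn γ → x occursIn φ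

  leftCompanion : Consequence → Consequence
  leftCompanion _⊢_ Γ φ = Σ FmSet (λ Γ′ → Γ′ ⊆ Γ × VarsIncluded Γ′ φ × Γ′ ⊢ φ)

  ECQ : Consequence → Set₁
  ECQ _⊢′_ = ∀ α β → pair α (¬′ α) ⊢′ β

{-# OPTIONS --safe #-}
module Submission where

open import Defs
open import Data.Nat using (ℕ)
open import Data.Product using (_×_; _,_)
open import Data.Sum using (inj₁; inj₂)
open import Data.Empty using (⊥-elim)
open import Relation.Nullary using (¬_)
open import Relation.Unary using (_∈_; _⊆_)
open import Relation.Binary.PropositionalEquality using (refl)

-- The only subsets of {p, ¬p} whose variables lie in var(α) are empty, and from the
-- empty set the companion proves only what the logic itself proves outright.

module _ {L : Language} where

  EmptySet : FmSet L → Set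
  EmptySet Γ = ∀ {ψ} → ¬ ψ ∈ Γ

  ⊢-of-EmptySet : ∀ {_⊢_ : Consequence L} → IsLogic L _⊢_ →
    ∀ {Γ φ} → EmptySet Γ → Γ ⊢ φ → ∅F L ⊢ φ
  ⊢-of-EmptySet lg Γ-empty Γ⊢φ = IsLogic.transitive lg (λ ψ∈Γ → ⊥-elim (Γ-empty ψ∈Γ)) Γ⊢φ

  EmptySet-of-⊆-pair : ∀ {p α Γ} → ¬ _occursIn_ L p α →
    Γ ⊆ pair L (var p) (¬′ (var p)) → VarsIncluded L Γ α → EmptySet Γ
  EmptySet-of-⊆-pair p∉α Γ⊆ vars ψ∈Γ with Γ⊆ ψ∈Γ
  ... | inj₁ refl = p∉α (vars ψ∈Γ here)
  ... | inj₂ refl = p∉α (vars ψ∈Γ (neg here))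

  ¬leftCompanion-pair : ∀ {_⊢_ : Consequence L} → IsLogic L _⊢_ →
    ∀ {α p} → ¬ (∅F L ⊢ α) → ¬ _occursIn_ L p α →
    ¬ leftCompanion L _⊢_ (pair L (var p) (¬′ (var p))) α
  ¬leftCompanion-pair lg ⊬α p∉α (Γ′ , Γ′⊆ , vars , Γ′⊢α) =
    ⊬α (⊢-of-EmptySet lg (EmptySet-of-⊆-pair p∉α Γ′⊆ vars) Γ′⊢α)

  ¬ECQ-of-counterexample : ∀ (_⊢′_ : Consequence L) {α β} →
    ¬ pair L α (¬′ α) ⊢′ β → ¬ ECQ L _⊢′_
  ¬ECQ-of-counterexample _ ⊬β ecq = ⊬β (ecq _ _)

theorem3p9 : (L : Language) (_⊢_ : Consequence L) → IsLogic L _⊢_ →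
    (α : Fm L) → ¬ (∅F L ⊢ α) → (p : ℕ) → ¬ (_occursIn_ L p α) →
    ¬ ECQ L (leftCompanion L _⊢_)
    × ¬ leftCompanion L _⊢_ (pair L (var p) (¬′ (var p))) α
theorem3p9 L _⊢_ lg α ⊬α p p∉α = ¬ECQ-of-counterexample (leftCompanion L _⊢_) p⊬α , p⊬α
  where
  p⊬α : ¬ leftCompanion L _⊢_ (pair L (var p) (¬′ (var p))) α
  p⊬α = ¬leftCompanion-pair lg ⊬α p∉α
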